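{- Let $C(x,y) \in \mathbb{C}[x,y]$ and write $C(x,y) = \sum_{m=0}^{l} C_m(x) y^m.$ Assume that one of the following conditions holds: \begin{enumerate} \item $\mathcal{A}$ forward-induces $\{a(n)\}_{n \geq 0}$ and $C(\omega, \widehat{M}(k^s;\omega)) = 0,$ \item $\mathcal{A}$ backward-induces $\{a(n)\}_{n \geq 0}$ and $C(\omega, \widehat{M}^R(k^s;\omega)) = 0.$ \end{enumerate} Then for all $n \geq 1$ we have $\sum_{m=0}^{l} C_m(\omega) A(k^{ms}n;\omega) = 0.$
   Context: Let $k \geq 2$, $\Sigma_k = \{0,\ldots,k-1\}$, $[w]_k$ the integer represented in base $k$ by a word $w$ (leading zeros allowed), $w^R$ the reversal of $w$. Let $\mathcal{A} = (Q,\Sigma_k,\delta,q_0,\Delta,\tau)$ be a deterministic finite automaton with output, $Q = \{q_0,\ldots,q_{d-1}\}$, $\delta$ extended to words by $\delta(q,\epsilon)=q$, $\delta(q,wa)=\delta(\delta(q,w),a)$, output function $\tau\colon Q\to\Delta\subset\mathbb{C}$. $\mathcal{A}$ forward-induces a sequence $\{a(n)\}_{n\ge0}$ if $a(n) = \tau(\delta(q_0,w))$ for all $n\ge 0$ and all words $w$ with $[w]_k=n$, and backward-induces it if $a(n) = \tau(\delta(q_0,w^R))$ for all such $w$. Let $A(n;x) = \sum_{m=0}^{n-1} a(m)x^m$. Let $f_i(w) = \tau(\delta(q_i,w))$ and $M(x)=[m_{ij}(x)]$ with $m_{ij}(x) = \sum_{a \in \Sigma_k,\ \delta(q_i,a)=q_j}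 x^a$. Assume (after renumbering states other than $q_0$) that $\{f_0,\ldots,f_c\}$ spans $\operatorname{span}_{\mathbb{C}}\{f_0,\ldots,f_{d-1}\}$, and for $c<p\le d-1$ write $f_p=\sum_{j=0}^c\alpha_{pj}f_j$. Let $\widehat{M}(x) = [\widehat{m}_{ij}(x)]_{0\le i,j\le c}$ with $\widehat{m}_{ij}(x) = m_{ij}(x)+\sum_{p=c+1}^{d-1}\alpha_{pj}m_{ip}(x)$ (so $\widehat M=M$ if $c=d-1$), and for $t\ge0$, $\widehat{M}(k^t;x) = \widehat{M}(x^{k^{t-1}})\cdots\widehat{M}(x^k)\widehat{M}(x)$ and $\widehat{M}^R(k^t;x) = \widehat{M}(x)\widehat{M}(x^k)\cdots\widehat{M}(x^{k^{t-1}})$. Fix $r \geq 1$ with $\gcd(r,k)=1$, let $\omega$ be any $r$th root of unity (not necessarily primitive), and take $s \geq 1$ with $k^s \equiv 1 \pmod{r}$. -}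

module Defs where

open import Level using (Level; _⊔_)
open import Data.Nat as ℕ using (ℕ; zero; suc)
open import Data.Fin using (Fin; zero; suc; toℕ; _↑ˡ_; _↑ʳ_; _≟_)
open import Data.List using (List; []; _∷_; foldl; reverse)
open import Data.Bool using (if_then_else_)
open import Relation.Nullary using (does)
open import Relation.Binary.PropositionalEquality using (_≡_)
open import Algebra.Bundles using (CommutativeRing)

-- [w]_k : the integer represented in base k by the word w
-- (most significant digit first; leading zeros allowed).
value : (k : ℕ) → List (Fin k) → ℕ
value k = foldl (λ acc a → acc ℕ.* k ℕ.+ toℕ a) 0

δ* : ∀ {d k : ℕ} → (Fin d → Fin k → Fin d) → Fin d → List (Fin k) → Fin d
δ* δ = foldl δ

-- The ring R plays the role of ℂ.
module _ {a b : Level} (R : CommutativeRing a b) where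
  open CommutativeRing R using (_≈_; _+_; _*_; 0#; 1#) renaming (Carrier to K)

  pow : K → ℕ → K
  pow x zero = 1#
  pow x (suc n) = x * pow x n

  sumFin : (n : ℕ) → (Fin n → K) → K
  sumFin zero f = 0#
  sumFin (suc n) f = f zero + sumFin n (λ i → f (suc i))

  sumℕ : ℕ → (ℕ → K) → K
  sumℕ zero f = 0#
  sumℕ (suc n) f = sumℕ n f + f n

  -- polynomials in one variable as coefficient lists (constant term first)
  evalPoly : List K → K → K
  evalPoly [] x = 0#
  evalPoly (c ∷ p) x = c + x * evalPoly p x

  Mat : ℕ → Set a
  Mat n = Fin n → Fin n → K

  idMat : (n : ℕ) → Mat n
  idMat n i j = if does (i ≟ j) then 1# else 0#

  mulMat : (n : ℕ) → Mat n → Mat n → Mat n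
  mulMat n A B i j = sumFin n (λ l → A i l * B l j)

  powMat : (n : ℕ) → Mat n → ℕ → Mat n
  powMat n A zero = idMat n
  powMat n A (suc m) = mulMat n A (powMat n A m)

  IsZeroMat : (n : ℕ) → Mat n → Set b
  IsZeroMat n A = ∀ i j → A i j ≈ 0#

  evalC : (l : ℕ) → (Fin (suc l) → List K) → K → (n : ℕ) → Mat n → Mat n
  evalC l C ω n Y i j = sumFin (suc l) (λ m → evalPoly (C m) ω * powMat n Y (toℕ m) i j)

  Apart : (ℕ → K) → ℕ → K → K
  Apart s n x = sumℕ n (λ m → s m * pow x m)

  -- forward / backward induction of a sequence by the automaton with
  -- states Fin (suc d), initial state q₀ = zero, transitions δ, output τ
  ForwardInduces : (k d : ℕ) → (Fin (suc d) → Fin k → Fin (suc d)) →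
                   (Fin (suc d) → K) → (ℕ → K) → Set b
  ForwardInduces k d δ τ s =
    ∀ (n : ℕ) (w : List (Fin k)) → value k w ≡ n → s n ≈ τ (δ* δ zero w)

  BackwardInduces : (k d : ℕ) → (Fin (suc d) → Fin k → Fin (suc d)) →
                    (Fin (suc d) → K) → (ℕ → K) → Set b
  BackwardInduces k d δ τ s =
    ∀ (n : ℕ) (w : List (Fin k)) → value k w ≡ n → s n ≈ τ (δ* δ zero (reverse w))

  -- States are Fin (suc c + e): q_0..q_c are  j ↑ˡ e  (j : Fin (suc c)),
  -- q_{c+1}..q_{d-1} are  suc c ↑ʳ p  (p : Fin e);  so d = c + 1 + e.
  -- f_i(w) = τ(δ(q_i, w))
  fState : (k c e : ℕ) → (Fin (suc c ℕ.+ e) → Fin k → Fin (suc c ℕ.+ e)) →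
           (Fin (suc c ℕ.+ e) → K) → Fin (suc c ℕ.+ e) → List (Fin k) → K
  fState k c e δ τ i w = τ (δ* δ i w)

  SpanRel : (k c e : ℕ) → (Fin (suc c ℕ.+ e) → Fin k → Fin (suc c ℕ.+ e)) →
            (Fin (suc c ℕ.+ e) → K) → (Fin e → Fin (suc c) → K) → Set b
  SpanRel k c e δ τ α =
    ∀ (p : Fin e) (w : List (Fin k)) →
      fState k c e δ τ (suc c ↑ʳ p) w ≈
      sumFin (suc c) (λ j → α p j * fState k c e δ τ (j ↑ˡ e) w)

  mEntry : (k d : ℕ) → (Fin d → Fin k → Fin d) → K → Fin d → Fin d → K
  mEntry k d δ x i j = sumFin k (λ t → if does (δ i t ≟ j) then pow x (toℕ t) else 0#)

  MHat : (k c e : ℕ) → (Fin (suc c ℕ.+ e) → Fin k → Fin (suc c ℕ.+ e)) →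
         (Fin e → Fin (suc c) → K) → K → Mat (suc c)
  MHat k c e δ α x i j =
    mEntry k (suc c ℕ.+ e) δ x (i ↑ˡ e) (j ↑ˡ e) +
    sumFin e (λ p → α p j * mEntry k (suc c ℕ.+ e) δ x (i ↑ˡ e) (suc c ↑ʳ p))

  MHatF : (k c e : ℕ) → (Fin (suc c ℕ.+ e) → Fin k → Fin (suc c ℕ.+ e)) →
          (Fin e → Fin (suc c) → K) → ℕ → K → Mat (suc c)
  MHatF k c e δ α zero x = idMat (suc c)
  MHatF k c e δ α (suc t) x =
    mulMat (suc c) (MHat k c e δ α (pow x (k ℕ.^ t))) (MHatF k c e δ α t x)

  MHatR : (k c e : ℕ) → (Fin (suc c ℕ.+ e) → Fin k → Fin (suc c ℕ.+ e)) →
          (Fin e → Fin (suc c) → K) → ℕ → K → Mat (suc c)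
  MHatR k c e δ α zero x = idMat (suc c)
  MHatR k c e δ α (suc t) x =
    mulMat (suc c) (MHatR k c e δ α t x) (MHat k c e δ α (pow x (k ℕ.^ t)))

{-# OPTIONS --safe #-}
module Submission where

-- Enumerate 0 ≤ q < k^t n by base-k words of a fixed length, so that the q-th term of
-- A(k^t n; y) is y^q times the output after reading the word of q.  Splitting off one digit a
-- writes the series over n k words at y as Σ_a y^a times a series over n words at y^k, with
-- the automaton advanced by a: a multiplication by M(y), which the span relations let us
-- replace by M̂(y) on the coordinates f_0, …, f_c.  Unrolling s digits gives the matrix
-- P = M̂(k^s; ω) (forward) or M̂^R(k^s; ω) (backward), and as ω^(k^s) = ω the same P recurs
-- every s digits.  Hence A(k^(ms) n; ω) = ⟨U, P^m W⟩ for vectors U, W independent of m, and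
-- Σ_m C_m(ω) A(k^(ms) n; ω) = ⟨U, C(ω, P) W⟩ = 0.

open import Defs
open import Level using (Level)
open import Data.Nat as ℕ using (ℕ; zero; suc; _≤_; _<_; _∸_; _^_; NonZero; z≤n; s≤s)
import Data.Nat.Properties as ℕₚ
open import Data.Nat.Divisibility using (_∣_; divides; n∣m*n)
open import Data.Nat.Coprimality using (Coprime)
open import Data.Fin using (Fin; zero; suc; toℕ; _↑ˡ_; _↑ʳ_; _≟_; splitAt; inject₁; fromℕ)
open import Data.List using (List; []; _∷_; _∷ʳ_; reverse)
open import Data.Product using (_×_; _,_)
open import Data.Sum using (_⊎_; inj₁; inj₂; [_,_]′)
open import Data.Bool using (if_then_else_)
open import Function using (_∘_)
open import Relation.Nullary using (does)
open import Relation.Binary.PropositionalEquality as ≡ using (_≡_; _≗_)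
open import Algebra.Bundles using (CommutativeRing)

iterate : ∀ {ℓ} {V : Set ℓ} → (V → V) → ℕ → V → V
iterate f zero    X = X
iterate f (suc m) X = iterate f m (f X)

n<m^n : ∀ {m} → 1 < m → ∀ n → n < m ^ n
n<m^n {m@(suc _)} 1<m zero    = s≤s z≤n
n<m^n {m@(suc _)} 1<m (suc n) = begin-strict
  suc n         ≤⟨ n<m^n 1<m n ⟩
  m ^ n         ≡⟨ ℕₚ.*-identityˡ (m ^ n) ⟨
  1 ℕ.* m ^ n   <⟨ ℕₚ.*-monoˡ-< (m ^ n) {{ℕₚ.m^n≢0 m n}} 1<m ⟩
  m ℕ.* m ^ n   ∎
  where open ℕₚ.≤-Reasoning

m^a*n≤m^[a+n] : ∀ {m} → 1 < m → ∀ a n → m ^ a ℕ.* n ≤ m ^ (a ℕ.+ n)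
m^a*n≤m^[a+n] {m} 1<m a n = ℕₚ.≤-trans (ℕₚ.*-monoʳ-≤ (m ^ a) (ℕₚ.<⇒≤ (n<m^n 1<m n)))
                                       (ℕₚ.≤-reflexive (≡.sym (ℕₚ.^-distribˡ-+-* m a n)))

module Digits (k : ℕ) .{{_ : NonZero k}} where

  open import Data.Nat using (_+_; _*_)
  open import Data.Nat.Properties
  open import Data.Nat.DivMod
  open import Data.Fin.Properties using (toℕ<n; toℕ-injective; toℕ-fromℕ<)
  open import Data.List.Properties using (foldl-∷ʳ)
  open ≡ using (cong; cong₂)
  open ≡.≡-Reasoning

  -- the length-L base-k expansion of q; it drops the leading digits when q ≥ k ^ L
  digits : ℕ → ℕ → List (Fin k)
  digits zero    q = []
  digits (suc L) q = digits L (q / k) ∷ʳ (q mod k)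

  digits-step : ∀ L q (a : Fin k) → digits (suc L) (q * k + toℕ a) ≡ digits L q ∷ʳ a
  digits-step L q a = cong₂ (λ q′ a′ → digits L q′ ∷ʳ a′) quotient remainder
    where
    quotient : (q * k + toℕ a) / k ≡ q
    quotient = begin
      (q * k + toℕ a) / k    ≡⟨ +-distrib-/-∣ˡ (toℕ a) (n∣m*n q) ⟩
      q * k / k + toℕ a / k  ≡⟨ cong₂ _+_ (m*n/n≡m q k) (m<n⇒m/n≡0 (toℕ<n a)) ⟩
      q + 0                  ≡⟨ +-identityʳ q ⟩
      q                      ∎
    remainder : (q * k + toℕ a) mod k ≡ a
    remainder = toℕ-injective (begin
      toℕ ((q * k + toℕ a) mod k)  ≡⟨ toℕ-fromℕ< _ ⟩
      (q * k + toℕ a) % k          ≡⟨ cong (_% k) (+-comm (q * k) (toℕ a)) ⟩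
      (toℕ a + q * k) % k          ≡⟨ [m+kn]%n≡m%n (toℕ a) q k ⟩
      toℕ a % k                    ≡⟨ m<n⇒m%n≡m (toℕ<n a) ⟩
      toℕ a                        ∎)

  value-digits : ∀ L q → q < k ^ L → value k (digits L q) ≡ q
  value-digits zero    zero    _        = ≡.refl
  value-digits zero    (suc q) (s≤s ())
  value-digits (suc L) q       q<kᴸ⁺¹ = begin
    value k (digits L (q / k) ∷ʳ (q mod k))      ≡⟨ foldl-∷ʳ _ 0 (q mod k) (digits L (q / k)) ⟩
    value k (digits L (q / k)) * k + toℕ (q mod k)
      ≡⟨ cong₂ (λ x y → x * k + y) (value-digits L (q / k) q/k<kᴸ) (toℕ-fromℕ< _) ⟩
    q / k * k + q % k                            ≡⟨ +-comm (q / k * k) (q % k) ⟩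
    q % k + q / k * k                            ≡⟨ m≡m%n+[m/n]*n q k ⟨
    q                                            ∎
    where
    q/k<kᴸ : q / k < k ^ L
    q/k<kᴸ = m<n*o⇒m/o<n (≡.subst (q <_) (*-comm k (k ^ L)) q<kᴸ⁺¹)

module _ {a b : Level} (R : CommutativeRing a b) where

  open CommutativeRing R hiding (zero) renaming (Carrier to K)
  open import Algebra.Properties.Semiring.Sum semiring
  open import Algebra.Properties.CommutativeSemigroup *-commutativeSemigroup using (x∙yz≈y∙xz; xy∙z≈y∙xz)
  import Algebra.Properties.Semiring.Exp semiring as Exp
  open import Data.Vec.Functional.Relation.Binary.Equality.Setoid setoid using (_≋_)
  open import Data.List.Properties using (foldl-∷ʳ; reverse-++)
  open import Data.Fin.Properties
    using (toℕ<n; toℕ-inject₁; toℕ-fromℕ; toℕ-↑ˡ; toℕ-↑ʳ; splitAt⁻¹-↑ˡ; splitAt⁻¹-↑ʳ)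
  open import Relation.Binary.Reasoning.Setoid setoid

  sumFin≡sum : ∀ n (f : Fin n → K) → sumFin R n f ≡ sum f
  sumFin≡sum zero    f = ≡.refl
  sumFin≡sum (suc n) f = ≡.cong (f zero +_) (sumFin≡sum n (f ∘ suc))

  sumℕ≈sum : ∀ n (h : ℕ → K) → sumℕ R n h ≈ ∑[ i < n ] h (toℕ i)
  sumℕ≈sum zero    h = refl
  sumℕ≈sum (suc n) h = begin
    sumℕ R n h + h n                         ≈⟨ +-congʳ (sumℕ≈sum n h) ⟩
    ∑[ i < n ] h (toℕ i) + h n
      ≡⟨ ≡.cong₂ _+_ (sum-cong-≗ {n} (≡.cong h ∘ ≡.sym ∘ toℕ-inject₁))
                    (≡.cong h (≡.sym (toℕ-fromℕ n))) ⟩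
    ∑[ i < n ] h (toℕ (inject₁ i)) + h (toℕ (fromℕ n))  ≈⟨ sum-init-last (h ∘ toℕ) ⟨
    ∑[ i < suc n ] h (toℕ i)                 ∎

  sum-splitAt : ∀ m {n} (f : Fin (m ℕ.+ n) → K) →
                sum f ≈ ∑[ i < m ] f (i ↑ˡ n) + ∑[ j < n ] f (m ↑ʳ j)
  sum-splitAt zero    f = sym (+-identityˡ _)
  sum-splitAt (suc m) f = trans (+-congˡ (sum-splitAt m (f ∘ suc))) (sym (+-assoc _ _ _))

  sum-blocks : ∀ n k (g : ℕ → K) →
               ∑[ q < n ℕ.* k ] g (toℕ q) ≈ ∑[ q < n ] ∑[ a < k ] g (toℕ q ℕ.* k ℕ.+ toℕ a)
  sum-blocks zero    k g = refl
  sum-blocks (suc n) k g = begin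
    ∑[ q < k ℕ.+ n ℕ.* k ] g (toℕ q)
      ≈⟨ sum-splitAt k (g ∘ toℕ) ⟩
    ∑[ a < k ] g (toℕ (a ↑ˡ n ℕ.* k)) + ∑[ q < n ℕ.* k ] g (toℕ (k ↑ʳ q))
      ≡⟨ ≡.cong₂ _+_ (sum-cong-≗ {k} (λ a → ≡.cong g (toℕ-↑ˡ a _)))
                    (sum-cong-≗ {n ℕ.* k} (λ q → ≡.cong g (toℕ-↑ʳ k q))) ⟩
    ∑[ a < k ] g (toℕ a) + ∑[ q < n ℕ.* k ] g (k ℕ.+ toℕ q)
      ≈⟨ +-congˡ (sum-blocks n k (λ i → g (k ℕ.+ i))) ⟩
    ∑[ a < k ] g (toℕ a) + ∑[ q < n ] ∑[ a < k ] g (k ℕ.+ (toℕ q ℕ.* k ℕ.+ toℕ a))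
      ≡⟨ ≡.cong (∑[ a < k ] g (toℕ a) +_) (sum-cong-≗ {n} (λ q → sum-cong-≗ {k} (λ a →
           ≡.cong g (≡.sym (ℕₚ.+-assoc k (toℕ q ℕ.* k) (toℕ a)))))) ⟩
    ∑[ q < suc n ] ∑[ a < k ] g (toℕ q ℕ.* k ℕ.+ toℕ a) ∎

  sum-select : ∀ {n} (t : Fin n) x (g : Fin n → K) →
               ∑[ i < n ] ((if does (t ≟ i) then x else 0#) * g i) ≈ x * g t
  sum-select {suc n} zero x g =
    trans (+-congˡ (trans (sum-cong-≋ (λ i → zeroˡ (g (suc i)))) (sum-replicate-zero n))) (+-identityʳ _)
  sum-select {suc n} (suc t) x g =
    trans (+-congʳ (zeroˡ _)) (trans (+-identityˡ _) (sum-select t x (g ∘ suc)))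

  sum-selectʳ : ∀ {n} (t : Fin n) (g : Fin n → K) → ∑[ i < n ] (g i * idMat R n i t) ≈ g t
  sum-selectʳ {suc n} zero g =
    trans (+-cong (*-identityʳ _) (trans (sum-cong-≋ (λ i → zeroʳ (g (suc i)))) (sum-replicate-zero n)))
          (+-identityʳ _)
  sum-selectʳ {suc n} (suc t) g =
    trans (+-congʳ (zeroʳ _)) (trans (+-identityˡ _) (sum-selectʳ t (g ∘ suc)))

  pow≡^ : ∀ x n → pow R x n ≡ x Exp.^ n
  pow≡^ x zero    = ≡.refl
  pow≡^ x (suc n) = ≡.cong (x *_) (pow≡^ x n)

  pow-congˡ : ∀ {x y} n → x ≈ y → pow R x n ≈ pow R y n
  pow-congˡ {x} {y} n x≈y rewrite pow≡^ x n | pow≡^ y n = Exp.^-congˡ n x≈y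

  pow-+ : ∀ x m n → pow R x (m ℕ.+ n) ≈ pow R x m * pow R x n
  pow-+ x m n rewrite pow≡^ x (m ℕ.+ n) | pow≡^ x m | pow≡^ x n = Exp.^-homo-* x m n

  pow-pow : ∀ x m n → pow R (pow R x m) n ≈ pow R x (n ℕ.* m)
  pow-pow x m n rewrite pow≡^ (pow R x m) n | pow≡^ x m | pow≡^ x (n ℕ.* m) =
    trans (Exp.^-assocʳ x m n) (Exp.^-congʳ x (ℕₚ.*-comm m n))

  pow-1# : ∀ n → pow R 1# n ≈ 1#
  pow-1# zero    = refl
  pow-1# (suc n) = trans (*-identityˡ _) (pow-1# n)

  pow-periodic : ∀ {x r N} → pow R x r ≈ 1# → r ∣ N ∸ 1 → 0 < N → pow R x N ≈ x
  pow-periodic {x} {r} {suc _} xʳ≈1 (divides j ≡.refl) _ = begin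
    x * pow R x (j ℕ.* r)    ≈⟨ *-congˡ (pow-pow x r j) ⟨
    x * pow R (pow R x r) j  ≈⟨ *-congˡ (trans (pow-congˡ j xʳ≈1) (pow-1# j)) ⟩
    x * 1#                   ≈⟨ *-identityʳ x ⟩
    x                        ∎

  ⟨_,_⟩ : ∀ {n} → (Fin n → K) → (Fin n → K) → K
  ⟨_,_⟩ {n} u w = ∑[ i < n ] (u i * w i)

  infixl 7 _⊙_
  infixr 7 _⊛_

  _⊙_ : ∀ {n} → (Fin n → K) → Mat R n → Fin n → K
  (u ⊙ A) j = ⟨ u , (λ i → A i j) ⟩

  _⊛_ : ∀ {n} → Mat R n → (Fin n → K) → Fin n → K
  (A ⊛ w) i = ⟨ A i , w ⟩

  infix 4 _≈ᴹ_
  _≈ᴹ_ : ∀ {n} → Mat R n → Mat R n → Set b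
  A ≈ᴹ B = ∀ i j → A i j ≈ B i j

  module _ {n : ℕ} where

    ⟨,⟩-comm : (u w : Fin n → K) → ⟨ u , w ⟩ ≈ ⟨ w , u ⟩
    ⟨,⟩-comm u w = sum-cong-≋ (λ i → *-comm (u i) (w i))

    ⟨,⟩-congˡ : ∀ {u u′} (w : Fin n → K) → u ≋ u′ → ⟨ u , w ⟩ ≈ ⟨ u′ , w ⟩
    ⟨,⟩-congˡ w u≋u′ = sum-cong-≋ (λ i → *-congʳ (u≋u′ i))

    ⟨,⟩-congʳ : ∀ (u : Fin n → K) {w w′} → w ≋ w′ → ⟨ u , w ⟩ ≈ ⟨ u , w′ ⟩
    ⟨,⟩-congʳ u w≋w′ = sum-cong-≋ (λ i → *-congˡ (w≋w′ i))

    ⟨,⟩-zeroʳ : ∀ (u : Fin n → K) {w} → (∀ i → w i ≈ 0#) → ⟨ u , w ⟩ ≈ 0#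
    ⟨,⟩-zeroʳ u w≈0 = trans (sum-cong-≋ (λ i → trans (*-congˡ (w≈0 i)) (zeroʳ (u i)))) (sum-replicate-zero n)

    ⟨,⟩-+ˡ : ∀ (u u′ w : Fin n → K) → ⟨ u , w ⟩ + ⟨ u′ , w ⟩ ≈ ⟨ (λ i → u i + u′ i) , w ⟩
    ⟨,⟩-+ˡ u u′ w = sym (trans (sum-cong-≋ (λ i → distribʳ (w i) (u i) (u′ i)))
                               (∑-distrib-+ (λ i → u i * w i) (λ i → u′ i * w i)))

    ∑-⟨,⟩ʳ : ∀ {m} (x : Fin m → K) (u : Fin n → K) (g : Fin m → Fin n → K) →
             ∑[ a < m ] (x a * ⟨ u , g a ⟩) ≈ ⟨ u , (λ j → ∑[ a < m ] (x a * g a j)) ⟩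
    ∑-⟨,⟩ʳ {m} x u g = begin
      ∑[ a < m ] (x a * ⟨ u , g a ⟩)
        ≈⟨ sum-cong-≋ (λ a → *-distribˡ-sum (x a) (λ j → u j * g a j)) ⟩
      ∑[ a < m ] ∑[ j < n ] (x a * (u j * g a j))
        ≈⟨ ∑-comm (λ a j → x a * (u j * g a j)) ⟩
      ∑[ j < n ] ∑[ a < m ] (x a * (u j * g a j))
        ≈⟨ sum-cong-≋ (λ j → sum-cong-≋ (λ a → x∙yz≈y∙xz (x a) (u j) (g a j))) ⟩
      ∑[ j < n ] ∑[ a < m ] (u j * (x a * g a j))
        ≈⟨ sum-cong-≋ (λ j → *-distribˡ-sum (u j) (λ a → x a * g a j)) ⟨
      ⟨ u , (λ j → ∑[ a < m ] (x a * g a j)) ⟩ ∎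

    ∑-⟨,⟩ˡ : ∀ {m} (x : Fin m → K) (g : Fin m → Fin n → K) (w : Fin n → K) →
             ∑[ a < m ] (x a * ⟨ g a , w ⟩) ≈ ⟨ (λ j → ∑[ a < m ] (x a * g a j)) , w ⟩
    ∑-⟨,⟩ˡ x g w = begin
      ∑[ a < _ ] (x a * ⟨ g a , w ⟩)        ≈⟨ sum-cong-≋ (λ a → *-congˡ (⟨,⟩-comm (g a) w)) ⟩
      ∑[ a < _ ] (x a * ⟨ w , g a ⟩)        ≈⟨ ∑-⟨,⟩ʳ x w g ⟩
      ⟨ w , (λ j → ∑[ a < _ ] (x a * g a j)) ⟩ ≈⟨ ⟨,⟩-comm w _ ⟩
      ⟨ (λ j → ∑[ a < _ ] (x a * g a j)) , w ⟩ ∎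

    ⟨⊙,⟩ : ∀ (u : Fin n → K) A w → ⟨ u ⊙ A , w ⟩ ≈ ⟨ u , A ⊛ w ⟩
    ⟨⊙,⟩ u A w = sym (∑-⟨,⟩ˡ u A w)

    ⊙-congˡ : ∀ {u u′ : Fin n → K} (A : Mat R n) → u ≋ u′ → u ⊙ A ≋ u′ ⊙ A
    ⊙-congˡ A u≋u′ j = ⟨,⟩-congˡ (λ i → A i j) u≋u′

    ⊛-congʳ : ∀ (A : Mat R n) {w w′} → w ≋ w′ → A ⊛ w ≋ A ⊛ w′
    ⊛-congʳ A w≋w′ i = ⟨,⟩-congʳ (A i) w≋w′

    ⊛-congˡ : ∀ {A A′ : Mat R n} w → A ≈ᴹ A′ → A ⊛ w ≋ A′ ⊛ w
    ⊛-congˡ w A≈A′ i = ⟨,⟩-congˡ w (A≈A′ i)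

    mulMat-row : ∀ (A B : Mat R n) i → mulMat R n A B i ≋ A i ⊙ B
    mulMat-row A B i j = reflexive (sumFin≡sum n _)

    ⊙-assoc : ∀ (u : Fin n → K) A B → (u ⊙ A) ⊙ B ≋ u ⊙ mulMat R n A B
    ⊙-assoc u A B j = begin
      ⟨ u ⊙ A , (λ l → B l j) ⟩                   ≈⟨ ⟨⊙,⟩ u A _ ⟩
      ⟨ u , A ⊛ (λ l → B l j) ⟩                   ≈⟨ ⟨,⟩-congʳ u (λ i → mulMat-row A B i j) ⟨
      ⟨ u , (λ i → mulMat R n A B i j) ⟩          ∎

    ⊛-assoc : ∀ (A B : Mat R n) w → A ⊛ (B ⊛ w) ≋ mulMat R n A B ⊛ w
    ⊛-assoc A B w i = begin
      ⟨ A i , B ⊛ w ⟩             ≈⟨ ⟨⊙,⟩ (A i) B w ⟨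
      ⟨ A i ⊙ B , w ⟩             ≈⟨ ⟨,⟩-congˡ w (mulMat-row A B i) ⟨
      ⟨ mulMat R n A B i , w ⟩    ∎

    mulMat-assoc : ∀ (A B C : Mat R n) → mulMat R n (mulMat R n A B) C ≈ᴹ mulMat R n A (mulMat R n B C)
    mulMat-assoc A B C i j = begin
      mulMat R n (mulMat R n A B) C i j  ≈⟨ mulMat-row (mulMat R n A B) C i j ⟩
      ⟨ mulMat R n A B i , (λ l → C l j) ⟩ ≈⟨ ⟨,⟩-congˡ (λ l → C l j) (mulMat-row A B i) ⟩
      ⟨ A i ⊙ B , (λ l → C l j) ⟩        ≈⟨ ⟨⊙,⟩ (A i) B (λ l → C l j) ⟩
      ⟨ A i , B ⊛ (λ l → C l j) ⟩        ≈⟨ ⟨,⟩-congʳ (A i) (λ l → mulMat-row B C l j) ⟨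
      ⟨ A i , (λ l → mulMat R n B C l j) ⟩ ≈⟨ mulMat-row A (mulMat R n B C) i j ⟨
      mulMat R n A (mulMat R n B C) i j  ∎

    ⊙-identityʳ : ∀ (u : Fin n → K) → u ⊙ idMat R n ≋ u
    ⊙-identityʳ u j = sum-selectʳ j u

    ⊛-identityˡ : ∀ (w : Fin n → K) → idMat R n ⊛ w ≋ w
    ⊛-identityˡ w i = trans (sum-select i 1# w) (*-identityˡ (w i))

    mulMat-comm-powMat : ∀ (A : Mat R n) m → mulMat R n (powMat R n A m) A ≈ᴹ mulMat R n A (powMat R n A m)
    mulMat-comm-powMat A zero i j = begin
      mulMat R n (idMat R n) A i j  ≈⟨ mulMat-row (idMat R n) A i j ⟩
      (idMat R n ⊛ (λ l → A l j)) i ≈⟨ ⊛-identityˡ (λ l → A l j) i ⟩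
      A i j                         ≈⟨ ⊙-identityʳ (A i) j ⟨
      (A i ⊙ idMat R n) j           ≈⟨ mulMat-row A (idMat R n) i j ⟨
      mulMat R n A (idMat R n) i j  ∎
    mulMat-comm-powMat A (suc m) i j = begin
      mulMat R n (mulMat R n A Aᵐ) A i j     ≈⟨ mulMat-assoc A Aᵐ A i j ⟩
      mulMat R n A (mulMat R n Aᵐ A) i j     ≈⟨ mulMat-row A (mulMat R n Aᵐ A) i j ⟩
      ⟨ A i , (λ l → mulMat R n Aᵐ A l j) ⟩  ≈⟨ ⟨,⟩-congʳ (A i) (λ l → mulMat-comm-powMat A m l j) ⟩
      ⟨ A i , (λ l → mulMat R n A Aᵐ l j) ⟩  ≈⟨ mulMat-row A (mulMat R n A Aᵐ) i j ⟨
      mulMat R n A (mulMat R n A Aᵐ) i j     ∎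
      where
      Aᵐ : Mat R n
      Aᵐ = powMat R n A m

  evalC-annihilates : ∀ l C ω {n} (A : Mat R n) w i → IsZeroMat R n (evalC R l C ω n A) →
    ∑[ m < suc l ] (evalPoly R (C m) ω * (powMat R n A (toℕ m) ⊛ w) i) ≈ 0#
  evalC-annihilates l C ω A w i Z = begin
    ∑[ m < suc l ] (evalPoly R (C m) ω * ⟨ powMat R _ A (toℕ m) i , w ⟩)
      ≈⟨ ∑-⟨,⟩ˡ (λ m → evalPoly R (C m) ω) (λ m → powMat R _ A (toℕ m) i) w ⟩
    ⟨ (λ j → ∑[ m < suc l ] (evalPoly R (C m) ω * powMat R _ A (toℕ m) i j)) , w ⟩
      ≈⟨ ⟨,⟩-comm _ w ⟩
    ⟨ w , (λ j → ∑[ m < suc l ] (evalPoly R (C m) ω * powMat R _ A (toℕ m) i j)) ⟩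
      ≈⟨ ⟨,⟩-zeroʳ w (λ j → trans (reflexive (≡.sym (sumFin≡sum (suc l) (entry j)))) (Z i j)) ⟩
    0# ∎
    where
    entry : Fin _ → Fin (suc l) → K
    entry j m = evalPoly R (C m) ω * powMat R _ A (toℕ m) i j

  -- Rep L n y X: X describes a series over the first n words of length L, evaluated at y.
  module Unfolding (k : ℕ) {ℓ ℓ′} {V : Set ℓ} (Rep : ℕ → ℕ → K → V → Set ℓ′)
    (Rep-resp : ∀ {L n y y′ X} → y ≈ y′ → Rep L n y X → Rep L n y′ X)
    (step : K → V → V)
    (Rep-step : ∀ {L n y X} → Rep L n (pow R y k) X → Rep (suc L) (n ℕ.* k) y (step y X)) where

    open import Data.Nat.Solver using (module +-*-Solver)
    open +-*-Solver

    steps : ℕ → K → V → V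
    steps zero    x X = X
    steps (suc t) x X = steps t x (step (pow R x (k ^ t)) X)

    Rep-steps : ∀ t {L n x X} → Rep L n (pow R x (k ^ t)) X → Rep (t ℕ.+ L) (k ^ t ℕ.* n) x (steps t x X)
    Rep-steps zero {L} {n} {x} {X} rep =
      ≡.subst (λ N → Rep L N x X) (≡.sym (ℕₚ.+-identityʳ n)) (Rep-resp (*-identityʳ x) rep)
    Rep-steps (suc t) {L} {n} {x} {X} rep =
      ≡.subst₂ (λ L′ N → Rep L′ N x (steps (suc t) x X)) (ℕₚ.+-suc t L)
        (solve 3 (λ p n k → p :* (n :* k) := k :* p :* n) ≡.refl (k ^ t) n k)
        (Rep-steps t (Rep-step (Rep-resp (sym (pow-pow x (k ^ t) k)) rep)))

    Rep-periodic : ∀ {s x} → pow R x (k ^ s) ≈ x →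
      ∀ m {L n X} → Rep L n x X → Rep (m ℕ.* s ℕ.+ L) (k ^ (m ℕ.* s) ℕ.* n) x (iterate (steps s x) m X)
    Rep-periodic periodic zero {L} {n} {X} rep = ≡.subst (λ N → Rep L N _ X) (≡.sym (ℕₚ.+-identityʳ n)) rep
    Rep-periodic {s} {x} periodic (suc m) {L} {n} {X} rep =
      ≡.subst₂ (λ L′ N → Rep L′ N x (iterate (steps s x) (suc m) X))
        (solve 3 (λ m s L → m :* s :+ (s :+ L) := s :+ m :* s :+ L) ≡.refl m s L)
        (≡.trans (solve 3 (λ p q n → p :* (q :* n) := q :* p :* n) ≡.refl (k ^ (m ℕ.* s)) (k ^ s) n)
                 (≡.cong (ℕ._* n) (≡.sym (ℕₚ.^-distribˡ-+-* k s (m ℕ.* s)))))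
        (Rep-periodic periodic m (Rep-steps s (Rep-resp (sym periodic) rep)))

  module _ (k : ℕ) .{{_ : NonZero k}} where

    open Digits k

    digitSeries : ℕ → ℕ → K → (List (Fin k) → K) → K
    digitSeries L n y F = ∑[ q < n ] (pow R y (toℕ q) * F (digits L (toℕ q)))

    digitSeries-congʸ : ∀ L n {y y′} F → y ≈ y′ → digitSeries L n y F ≈ digitSeries L n y′ F
    digitSeries-congʸ L n F y≈y′ = sum-cong-≋ {n} (λ q → *-congʳ (pow-congˡ (toℕ q) y≈y′))

    digitSeries-congᶠ : ∀ L n y {F F′} → F ≗ F′ → digitSeries L n y F ≡ digitSeries L n y F′
    digitSeries-congᶠ L n y F≗F′ =
      sum-cong-≗ {n} (λ q → ≡.cong (pow R y (toℕ q) *_) (F≗F′ (digits L (toℕ q))))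

    digitSeries-step : ∀ L n y F →
      digitSeries (suc L) (n ℕ.* k) y F ≈
      ∑[ a < k ] (pow R y (toℕ a) * digitSeries L n (pow R y k) (λ w → F (w ∷ʳ a)))
    digitSeries-step L n y F = begin
      digitSeries (suc L) (n ℕ.* k) y F
        ≈⟨ sum-blocks n k term ⟩
      ∑[ q < n ] ∑[ a < k ] term (toℕ q ℕ.* k ℕ.+ toℕ a)
        ≈⟨ sum-cong-≋ {n} (λ q → sum-cong-≋ {k} (λ a → split-term q a)) ⟩
      ∑[ q < n ] ∑[ a < k ] (pow R y (toℕ a) * G q a)
        ≈⟨ ∑-comm {n} {k} (λ q a → pow R y (toℕ a) * G q a) ⟩
      ∑[ a < k ] ∑[ q < n ] (pow R y (toℕ a) * G q a)
        ≈⟨ sum-cong-≋ {k} (λ a → *-distribˡ-sum {n} (pow R y (toℕ a)) (λ q → G q a)) ⟨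
      ∑[ a < k ] (pow R y (toℕ a) * digitSeries L n (pow R y k) (λ w → F (w ∷ʳ a))) ∎
      where
      term : ℕ → K
      term i = pow R y i * F (digits (suc L) i)
      G : Fin n → Fin k → K
      G q a = pow R (pow R y k) (toℕ q) * F (digits L (toℕ q) ∷ʳ a)
      split-term : ∀ q a → term (toℕ q ℕ.* k ℕ.+ toℕ a) ≈ pow R y (toℕ a) * G q a
      split-term q a = begin
        pow R y (toℕ q ℕ.* k ℕ.+ toℕ a) * F (digits (suc L) (toℕ q ℕ.* k ℕ.+ toℕ a))
          ≈⟨ *-cong (pow-+ y (toℕ q ℕ.* k) (toℕ a)) (reflexive (≡.cong F (digits-step L (toℕ q) a))) ⟩
        pow R y (toℕ q ℕ.* k) * pow R y (toℕ a) * F (digits L (toℕ q) ∷ʳ a)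
          ≈⟨ *-congʳ (*-congʳ (pow-pow y k (toℕ q))) ⟨
        pow R (pow R y k) (toℕ q) * pow R y (toℕ a) * F (digits L (toℕ q) ∷ʳ a)
          ≈⟨ xy∙z≈y∙xz _ _ _ ⟩
        pow R y (toℕ a) * G q a ∎

    Apart≈digitSeries : ∀ {sq : ℕ → K} {F : List (Fin k) → K} L N x →
      (∀ w → sq (value k w) ≈ F w) → N ≤ k ^ L → Apart R sq N x ≈ digitSeries L N x F
    Apart≈digitSeries {sq} {F} L N x induces N≤kᴸ = begin
      sumℕ R N (λ q → sq q * pow R x q)     ≈⟨ sumℕ≈sum N _ ⟩
      ∑[ q < N ] (sq (toℕ q) * pow R x (toℕ q))
        ≈⟨ sum-cong-≋ (λ q → trans (*-comm _ _) (*-congˡ (sq≈F q))) ⟩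
      digitSeries L N x F                    ∎
      where
      sq≈F : ∀ (q : Fin N) → sq (toℕ q) ≈ F (digits L (toℕ q))
      sq≈F q = trans (reflexive (≡.cong sq (≡.sym (value-digits L (toℕ q) q<kᴸ)))) (induces _)
        where
        q<kᴸ : toℕ q < k ^ L
        q<kᴸ = ℕₚ.<-≤-trans (toℕ<n q) N≤kᴸ

    module _ (c e : ℕ) (δ : Fin (suc c ℕ.+ e) → Fin k → Fin (suc c ℕ.+ e))
             (α : Fin e → Fin (suc c) → K) where

      Spanned : (Fin (suc c ℕ.+ e) → K) → Set b
      Spanned F = ∀ p → F (suc c ↑ʳ p) ≈ ⟨ α p , F ∘ (_↑ˡ e) ⟩

      Spanned-∑ : ∀ {m} (x : Fin m → K) (F : Fin m → Fin (suc c ℕ.+ e) → K) →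
                  (∀ q → Spanned (F q)) → Spanned (λ i → ∑[ q < m ] (x q * F q i))
      Spanned-∑ x F spanned p =
        trans (sum-cong-≋ (λ q → *-congˡ (spanned q p))) (∑-⟨,⟩ʳ x (α p) (λ q j → F q (j ↑ˡ e)))

      coords : Fin (suc c ℕ.+ e) → Fin (suc c) → K
      coords i = [ idMat R (suc c) , α ]′ (splitAt (suc c) i)

      Spanned⇒coords : ∀ F → Spanned F → ∀ i → F i ≈ ⟨ coords i , F ∘ (_↑ˡ e) ⟩
      Spanned⇒coords F spanned i with splitAt (suc c) i in eq
      ... | inj₁ j = ≡.subst (λ i′ → F i′ ≈ ⟨ idMat R (suc c) j , F ∘ (_↑ˡ e) ⟩)
                       (splitAt⁻¹-↑ˡ eq) (sym (⊛-identityˡ (F ∘ (_↑ˡ e)) j))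
      ... | inj₂ p = ≡.subst (λ i′ → F i′ ≈ ⟨ α p , F ∘ (_↑ˡ e) ⟩)
                       (splitAt⁻¹-↑ʳ eq) (spanned p)

      M : K → Mat R (suc c ℕ.+ e)
      M = mEntry R k (suc c ℕ.+ e) δ

      M̂ : K → Mat R (suc c)
      M̂ = MHat R k c e δ α

      successors≈M⊛ : ∀ y F i → ∑[ a < k ] (pow R y (toℕ a) * F (δ i a)) ≈ (M y ⊛ F) i
      successors≈M⊛ y F i = begin
        ∑[ a < k ] (pow R y (toℕ a) * F (δ i a))
          ≈⟨ sum-cong-≋ (λ a → sum-select (δ i a) _ F) ⟨
        ∑[ a < k ] ∑[ i′ < _ ] (hit a i′ * F i′)
          ≈⟨ ∑-comm (λ a i′ → hit a i′ * F i′) ⟩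
        ∑[ i′ < _ ] ∑[ a < k ] (hit a i′ * F i′)
          ≈⟨ sum-cong-≋ (λ i′ → *-distribʳ-sum (F i′) (λ a → hit a i′)) ⟨
        ∑[ i′ < _ ] (∑[ a < k ] hit a i′ * F i′)
          ≈⟨ ⟨,⟩-congˡ F (λ i′ → reflexive (≡.sym (sumFin≡sum k (λ a → hit a i′)))) ⟩
        (M y ⊛ F) i ∎
        where
        hit : Fin k → Fin (suc c ℕ.+ e) → K
        hit a i′ = if does (δ i a ≟ i′) then pow R y (toℕ a) else 0#

      M⊛≈M̂⊛ : ∀ y F → Spanned F → ∀ j → (M y ⊛ F) (j ↑ˡ e) ≈ (M̂ y ⊛ (F ∘ (_↑ˡ e))) j
      M⊛≈M̂⊛ y F spanned j = begin
        ⟨ Mⱼ , F ⟩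
          ≈⟨ sum-splitAt (suc c) (λ i′ → Mⱼ i′ * F i′) ⟩
        ⟨ Mⱼ ∘ (_↑ˡ e) , F ∘ (_↑ˡ e) ⟩ + ∑[ p < e ] (Mⱼ (suc c ↑ʳ p) * F (suc c ↑ʳ p))
          ≈⟨ +-congˡ (sum-cong-≋ {e} (λ p → *-congˡ (spanned p))) ⟩
        ⟨ Mⱼ ∘ (_↑ˡ e) , F ∘ (_↑ˡ e) ⟩ + ∑[ p < e ] (Mⱼ (suc c ↑ʳ p) * ⟨ α p , F ∘ (_↑ˡ e) ⟩)
          ≈⟨ +-congˡ (∑-⟨,⟩ˡ (λ p → Mⱼ (suc c ↑ʳ p)) α (F ∘ (_↑ˡ e))) ⟩
        ⟨ Mⱼ ∘ (_↑ˡ e) , F ∘ (_↑ˡ e) ⟩ + ⟨ viaα , F ∘ (_↑ˡ e) ⟩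
          ≈⟨ ⟨,⟩-+ˡ (Mⱼ ∘ (_↑ˡ e)) viaα (F ∘ (_↑ˡ e)) ⟩
        ⟨ (λ l → Mⱼ (l ↑ˡ e) + viaα l) , F ∘ (_↑ˡ e) ⟩
          ≈⟨ ⟨,⟩-congˡ {u′ = M̂ y j} (F ∘ (_↑ˡ e)) (λ l → +-congˡ (viaα≈ l)) ⟩
        (M̂ y ⊛ (F ∘ (_↑ˡ e))) j ∎
        where
        Mⱼ : Fin (suc c ℕ.+ e) → K
        Mⱼ = M y (j ↑ˡ e)
        viaα : Fin (suc c) → K
        viaα l = ∑[ p < e ] (Mⱼ (suc c ↑ʳ p) * α p l)
        viaα≈ : ∀ l → viaα l ≈ sumFin R e (λ p → α p l * Mⱼ (suc c ↑ʳ p))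
        viaα≈ l = trans (sum-cong-≋ (λ p → *-comm (Mⱼ (suc c ↑ʳ p)) (α p l)))
                        (reflexive (≡.sym (sumFin≡sum e (λ p → α p l * Mⱼ (suc c ↑ʳ p)))))

      successors≈M̂⊛ : ∀ y F → Spanned F → ∀ j →
        ∑[ a < k ] (pow R y (toℕ a) * F (δ (j ↑ˡ e) a)) ≈ (M̂ y ⊛ (F ∘ (_↑ˡ e))) j
      successors≈M̂⊛ y F spanned j = trans (successors≈M⊛ y F (j ↑ˡ e)) (M⊛≈M̂⊛ y F spanned j)

      module _ (τ : Fin (suc c ℕ.+ e) → K) (span : SpanRel R k c e δ τ α) where

        f : Fin (suc c ℕ.+ e) → List (Fin k) → K
        f i w = τ (δ* δ i w)

        f-spanned : ∀ w → Spanned (λ i → f i w)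
        f-spanned w p = trans (span p w) (reflexive (sumFin≡sum (suc c) (λ j → α p j * f (j ↑ˡ e) w)))

        basisValues : List (Fin k) → Fin (suc c) → K
        basisValues w j = f (j ↑ˡ e) w

        forwardSeries : ℕ → ℕ → K → List (Fin k) → K
        forwardSeries L n y v = digitSeries L n y (λ w → f (δ* δ zero w) v)

        ForwardRep : ℕ → ℕ → K → (Fin (suc c) → K) → Set b
        ForwardRep L n y U = ∀ v → forwardSeries L n y v ≈ ⟨ U , basisValues v ⟩

        forwardRep-resp : ∀ {L n y y′ U} → y ≈ y′ → ForwardRep L n y U → ForwardRep L n y′ U
        forwardRep-resp {L} {n} y≈y′ rep v =
          trans (sym (digitSeries-congʸ L n (λ w → f (δ* δ zero w) v) y≈y′)) (rep v)

        forwardRep-step : ∀ {L n y U} → ForwardRep L n (pow R y k) U →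
                          ForwardRep (suc L) (n ℕ.* k) y (U ⊙ M̂ y)
        forwardRep-step {L} {n} {y} {U} rep v = begin
          forwardSeries (suc L) (n ℕ.* k) y v
            ≈⟨ digitSeries-step L n y (λ w → f (δ* δ zero w) v) ⟩
          ∑[ a < k ] (pow R y (toℕ a) * digitSeries L n (pow R y k) (λ w → f (δ* δ zero (w ∷ʳ a)) v))
            ≡⟨ sum-cong-≗ {k} (λ a → ≡.cong (pow R y (toℕ a) *_) (digitSeries-congᶠ L n (pow R y k)
                 (λ w → ≡.cong (λ i → f i v) (foldl-∷ʳ δ zero a w)))) ⟩
          ∑[ a < k ] (pow R y (toℕ a) * forwardSeries L n (pow R y k) (a ∷ v))
            ≈⟨ sum-cong-≋ {k} (λ a → *-congˡ (rep (a ∷ v))) ⟩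
          ∑[ a < k ] (pow R y (toℕ a) * ⟨ U , basisValues (a ∷ v) ⟩)
            ≈⟨ ∑-⟨,⟩ʳ (λ a → pow R y (toℕ a)) U (λ a → basisValues (a ∷ v)) ⟩
          ⟨ U , (λ j → ∑[ a < k ] (pow R y (toℕ a) * f (δ (j ↑ˡ e) a) v)) ⟩
            ≈⟨ ⟨,⟩-congʳ U (successors≈M̂⊛ y (λ i → f i v) (f-spanned v)) ⟩
          ⟨ U , M̂ y ⊛ basisValues v ⟩
            ≈⟨ ⟨⊙,⟩ U (M̂ y) (basisValues v) ⟨
          ⟨ U ⊙ M̂ y , basisValues v ⟩ ∎

        initialRow : ℕ → ℕ → K → Fin (suc c) → K
        initialRow L n y l = digitSeries L n y (λ w → coords (δ* δ zero w) l)

        forwardRep-initial : ∀ L n y → ForwardRep L n y (initialRow L n y)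
        forwardRep-initial L n y v = begin
          forwardSeries L n y v
            ≈⟨ sum-cong-≋ {n} (λ q → *-congˡ (Spanned⇒coords (λ i → f i v) (f-spanned v) (reached q))) ⟩
          ∑[ q < n ] (pow R y (toℕ q) * ⟨ coords (reached q) , basisValues v ⟩)
            ≈⟨ ∑-⟨,⟩ˡ (λ q → pow R y (toℕ q)) (λ q → coords (reached q)) (basisValues v) ⟩
          ⟨ initialRow L n y , basisValues v ⟩ ∎
          where
          reached : Fin n → Fin (suc c ℕ.+ e)
          reached q = δ* δ zero (digits L (toℕ q))

        module Forward = Unfolding k ForwardRep (λ {L n y y′ U} → forwardRep-resp {L} {n} {y} {y′} {U})
                           (λ y U → U ⊙ M̂ y) (λ {L n y U} → forwardRep-step {L} {n} {y} {U})

        steps-⊙ : ∀ t x U → Forward.steps t x U ≋ U ⊙ MHatF R k c e δ α t x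
        steps-⊙ zero    x U j = sym (⊙-identityʳ U j)
        steps-⊙ (suc t) x U j = trans (steps-⊙ t x (U ⊙ M̂ (pow R x (k ^ t))) j)
                                      (⊙-assoc U (M̂ (pow R x (k ^ t))) (MHatF R k c e δ α t x) j)

        iterate-⊙ : ∀ s x m U → iterate (Forward.steps s x) m U ≋ U ⊙ powMat R (suc c) (MHatF R k c e δ α s x) m
        iterate-⊙ s x zero    U j = sym (⊙-identityʳ U j)
        iterate-⊙ s x (suc m) U j = begin
          iterate (Forward.steps s x) m (Forward.steps s x U) j
            ≈⟨ iterate-⊙ s x m (Forward.steps s x U) j ⟩
          (Forward.steps s x U ⊙ Pᵐ) j    ≈⟨ ⊙-congˡ Pᵐ (steps-⊙ s x U) j ⟩
          (U ⊙ P ⊙ Pᵐ) j                  ≈⟨ ⊙-assoc U P Pᵐ j ⟩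
          (U ⊙ mulMat R (suc c) P Pᵐ) j   ∎
          where
          P : Mat R (suc c)
          P = MHatF R k c e δ α s x
          Pᵐ : Mat R (suc c)
          Pᵐ = powMat R (suc c) P m

        forward-Apart : ∀ {sq} → ForwardInduces R k (c ℕ.+ e) δ τ sq → 1 < k →
          ∀ s ω → pow R ω (k ^ s) ≈ ω → ∀ n m →
          Apart R sq (k ^ (m ℕ.* s) ℕ.* n) ω ≈
          ⟨ initialRow n n ω , powMat R (suc c) (MHatF R k c e δ α s ω) m ⊛ basisValues [] ⟩
        forward-Apart {sq} induced k>1 s ω periodic n m = begin
          Apart R sq (k ^ (m ℕ.* s) ℕ.* n) ω
            ≈⟨ Apart≈digitSeries (m ℕ.* s ℕ.+ n) _ ω (λ w → induced _ w ≡.refl)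
                                 (m^a*n≤m^[a+n] k>1 (m ℕ.* s) n) ⟩
          forwardSeries (m ℕ.* s ℕ.+ n) (k ^ (m ℕ.* s) ℕ.* n) ω []
            ≈⟨ Forward.Rep-periodic periodic m (forwardRep-initial n n ω) [] ⟩
          ⟨ iterate (Forward.steps s ω) m U₀ , basisValues [] ⟩
            ≈⟨ ⟨,⟩-congˡ (basisValues []) (iterate-⊙ s ω m U₀) ⟩
          ⟨ U₀ ⊙ Pᵐ , basisValues [] ⟩
            ≈⟨ ⟨⊙,⟩ U₀ Pᵐ (basisValues []) ⟩
          ⟨ U₀ , Pᵐ ⊛ basisValues [] ⟩ ∎
          where
          U₀ : Fin (suc c) → K
          U₀ = initialRow n n ω
          Pᵐ : Mat R (suc c)
          Pᵐ = powMat R (suc c) (MHatF R k c e δ α s ω) m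

        forward-theorem : ∀ {sq} → ForwardInduces R k (c ℕ.+ e) δ τ sq → 1 < k →
          ∀ s ω → pow R ω (k ^ s) ≈ ω →
          ∀ l C → IsZeroMat R (suc c) (evalC R l C ω (suc c) (MHatF R k c e δ α s ω)) → ∀ n →
          sumFin R (suc l) (λ m → evalPoly R (C m) ω * Apart R sq (k ^ (toℕ m ℕ.* s) ℕ.* n) ω) ≈ 0#
        forward-theorem {sq} induced k>1 s ω periodic l C Z n = begin
          sumFin R (suc l) (λ m → cₘ m * Apart R sq (k ^ (toℕ m ℕ.* s) ℕ.* n) ω)
            ≡⟨ sumFin≡sum (suc l) (λ m → cₘ m * Apart R sq (k ^ (toℕ m ℕ.* s) ℕ.* n) ω) ⟩
          ∑[ m < suc l ] (cₘ m * Apart R sq (k ^ (toℕ m ℕ.* s) ℕ.* n) ω)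
            ≈⟨ sum-cong-≋ {suc l} (λ m → *-congˡ {cₘ m} (forward-Apart induced k>1 s ω periodic n (toℕ m))) ⟩
          ∑[ m < suc l ] (cₘ m * ⟨ U₀ , P^ m ⊛ basisValues [] ⟩)
            ≈⟨ ∑-⟨,⟩ʳ cₘ U₀ (λ m → P^ m ⊛ basisValues []) ⟩
          ⟨ U₀ , (λ j → ∑[ m < suc l ] (cₘ m * (P^ m ⊛ basisValues []) j)) ⟩
            ≈⟨ ⟨,⟩-zeroʳ U₀ (λ j → evalC-annihilates l C ω P (basisValues []) j Z) ⟩
          0# ∎
          where
          cₘ : Fin (suc l) → K
          cₘ m = evalPoly R (C m) ω
          P : Mat R (suc c)
          P = MHatF R k c e δ α s ω
          P^ : Fin (suc l) → Mat R (suc c)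
          P^ m = powMat R (suc c) P (toℕ m)
          U₀ : Fin (suc c) → K
          U₀ = initialRow n n ω

        backwardSeries : ℕ → ℕ → K → Fin (suc c ℕ.+ e) → K
        backwardSeries L n y i = digitSeries L n y (λ w → f i (reverse w))

        backwardSeries-spanned : ∀ L n y → Spanned (backwardSeries L n y)
        backwardSeries-spanned L n y =
          Spanned-∑ {n} (λ q → pow R y (toℕ q)) (λ q i → f i (reverse (digits L (toℕ q))))
                    (λ q → f-spanned (reverse (digits L (toℕ q))))

        BackwardRep : ℕ → ℕ → K → (Fin (suc c) → K) → Set b
        BackwardRep L n y W = ∀ j → backwardSeries L n y (j ↑ˡ e) ≈ W j

        backwardRep-resp : ∀ {L n y y′ W} → y ≈ y′ → BackwardRep L n y W → BackwardRep L n y′ W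
        backwardRep-resp {L} {n} y≈y′ rep j =
          trans (sym (digitSeries-congʸ L n (λ w → f (j ↑ˡ e) (reverse w)) y≈y′)) (rep j)

        backwardRep-step : ∀ {L n y W} → BackwardRep L n (pow R y k) W →
                           BackwardRep (suc L) (n ℕ.* k) y (M̂ y ⊛ W)
        backwardRep-step {L} {n} {y} {W} rep j = begin
          backwardSeries (suc L) (n ℕ.* k) y (j ↑ˡ e)
            ≈⟨ digitSeries-step L n y (λ w → f (j ↑ˡ e) (reverse w)) ⟩
          ∑[ a < k ] (pow R y (toℕ a) * digitSeries L n (pow R y k) (λ w → f (j ↑ˡ e) (reverse (w ∷ʳ a))))
            ≡⟨ sum-cong-≗ {k} (λ a → ≡.cong (pow R y (toℕ a) *_) (digitSeries-congᶠ L n (pow R y k)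
                 (λ w → ≡.cong (f (j ↑ˡ e)) (reverse-++ w (a ∷ []))))) ⟩
          ∑[ a < k ] (pow R y (toℕ a) * backwardSeries L n (pow R y k) (δ (j ↑ˡ e) a))
            ≈⟨ successors≈M̂⊛ y (backwardSeries L n (pow R y k)) (backwardSeries-spanned L n (pow R y k)) j ⟩
          (M̂ y ⊛ (λ l → backwardSeries L n (pow R y k) (l ↑ˡ e))) j
            ≈⟨ ⊛-congʳ (M̂ y) rep j ⟩
          (M̂ y ⊛ W) j ∎

        module Backward = Unfolding k BackwardRep (λ {L n y y′ W} → backwardRep-resp {L} {n} {y} {y′} {W})
                            (λ y W → M̂ y ⊛ W) (λ {L n y W} → backwardRep-step {L} {n} {y} {W})

        steps-⊛ : ∀ t x W → Backward.steps t x W ≋ MHatR R k c e δ α t x ⊛ W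
        steps-⊛ zero    x W i = sym (⊛-identityˡ W i)
        steps-⊛ (suc t) x W i = trans (steps-⊛ t x (M̂ (pow R x (k ^ t)) ⊛ W) i)
                                      (⊛-assoc (MHatR R k c e δ α t x) (M̂ (pow R x (k ^ t))) W i)

        iterate-⊛ : ∀ s x m W → iterate (Backward.steps s x) m W ≋ powMat R (suc c) (MHatR R k c e δ α s x) m ⊛ W
        iterate-⊛ s x zero    W i = sym (⊛-identityˡ W i)
        iterate-⊛ s x (suc m) W i = begin
          iterate (Backward.steps s x) m (Backward.steps s x W) i
            ≈⟨ iterate-⊛ s x m (Backward.steps s x W) i ⟩
          (Pᵐ ⊛ Backward.steps s x W) i   ≈⟨ ⊛-congʳ Pᵐ (steps-⊛ s x W) i ⟩
          (Pᵐ ⊛ P ⊛ W) i                  ≈⟨ ⊛-assoc Pᵐ P W i ⟩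
          (mulMat R (suc c) Pᵐ P ⊛ W) i   ≈⟨ ⊛-congˡ W (mulMat-comm-powMat P m) i ⟩
          (mulMat R (suc c) P Pᵐ ⊛ W) i   ∎
          where
          P : Mat R (suc c)
          P = MHatR R k c e δ α s x
          Pᵐ : Mat R (suc c)
          Pᵐ = powMat R (suc c) P m

        backward-Apart : ∀ {sq} → BackwardInduces R k (c ℕ.+ e) δ τ sq → 1 < k →
          ∀ s ω → pow R ω (k ^ s) ≈ ω → ∀ n m →
          Apart R sq (k ^ (m ℕ.* s) ℕ.* n) ω ≈
          (powMat R (suc c) (MHatR R k c e δ α s ω) m ⊛ (λ j → backwardSeries n n ω (j ↑ˡ e))) zero
        backward-Apart {sq} induced k>1 s ω periodic n m = begin
          Apart R sq (k ^ (m ℕ.* s) ℕ.* n) ω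
            ≈⟨ Apart≈digitSeries (m ℕ.* s ℕ.+ n) _ ω (λ w → induced _ w ≡.refl)
                                 (m^a*n≤m^[a+n] k>1 (m ℕ.* s) n) ⟩
          backwardSeries (m ℕ.* s ℕ.+ n) (k ^ (m ℕ.* s) ℕ.* n) ω zero
            ≈⟨ Backward.Rep-periodic periodic m {X = W₀} (λ j → refl) zero ⟩
          iterate (Backward.steps s ω) m W₀ zero
            ≈⟨ iterate-⊛ s ω m W₀ zero ⟩
          (powMat R (suc c) (MHatR R k c e δ α s ω) m ⊛ W₀) zero ∎
          where
          W₀ : Fin (suc c) → K
          W₀ j = backwardSeries n n ω (j ↑ˡ e)

        backward-theorem : ∀ {sq} → BackwardInduces R k (c ℕ.+ e) δ τ sq → 1 < k →
          ∀ s ω → pow R ω (k ^ s) ≈ ω →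
          ∀ l C → IsZeroMat R (suc c) (evalC R l C ω (suc c) (MHatR R k c e δ α s ω)) → ∀ n →
          sumFin R (suc l) (λ m → evalPoly R (C m) ω * Apart R sq (k ^ (toℕ m ℕ.* s) ℕ.* n) ω) ≈ 0#
        backward-theorem {sq} induced k>1 s ω periodic l C Z n = begin
          sumFin R (suc l) (λ m → cₘ m * Apart R sq (k ^ (toℕ m ℕ.* s) ℕ.* n) ω)
            ≡⟨ sumFin≡sum (suc l) (λ m → cₘ m * Apart R sq (k ^ (toℕ m ℕ.* s) ℕ.* n) ω) ⟩
          ∑[ m < suc l ] (cₘ m * Apart R sq (k ^ (toℕ m ℕ.* s) ℕ.* n) ω)
            ≈⟨ sum-cong-≋ {suc l} (λ m → *-congˡ {cₘ m} (backward-Apart induced k>1 s ω periodic n (toℕ m))) ⟩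
          ∑[ m < suc l ] (cₘ m * (powMat R (suc c) P (toℕ m) ⊛ W₀) zero)
            ≈⟨ evalC-annihilates l C ω P W₀ zero Z ⟩
          0# ∎
          where
          cₘ : Fin (suc l) → K
          cₘ m = evalPoly R (C m) ω
          P : Mat R (suc c)
          P = MHatR R k c e δ α s ω
          W₀ : Fin (suc c) → K
          W₀ j = backwardSeries n n ω (j ↑ˡ e)

theorem5p2 : ∀ {a b : Level} (R : CommutativeRing a b) →
    (k : ℕ) → 2 ≤ k →
    (c e : ℕ) →
    (δ : Fin (suc c ℕ.+ e) → Fin k → Fin (suc c ℕ.+ e)) →
    (τ : Fin (suc c ℕ.+ e) → CommutativeRing.Carrier R) →
    (α : Fin e → Fin (suc c) → CommutativeRing.Carrier R) →
    SpanRel R k c e δ τ α →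
    (r : ℕ) → 1 ≤ r → Coprime r k →
    (ω : CommutativeRing.Carrier R) →
    CommutativeRing._≈_ R (pow R ω r) (CommutativeRing.1# R) →
    (s : ℕ) → 1 ≤ s → r ∣ (k ^ s ∸ 1) →
    (sq : ℕ → CommutativeRing.Carrier R) →
    (l : ℕ) → (C : Fin (suc l) → List (CommutativeRing.Carrier R)) →
    ((ForwardInduces R k (c ℕ.+ e) δ τ sq ×
        IsZeroMat R (suc c) (evalC R l C ω (suc c) (MHatF R k c e δ α s ω)))
     ⊎
     (BackwardInduces R k (c ℕ.+ e) δ τ sq ×
        IsZeroMat R (suc c) (evalC R l C ω (suc c) (MHatR R k c e δ α s ω)))) →
    (n : ℕ) → 1 ≤ n →
    CommutativeRing._≈_ R
      (sumFin R (suc l) (λ m →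
         CommutativeRing._*_ R (evalPoly R (C m) ω)
                               (Apart R sq (k ^ (toℕ m ℕ.* s) ℕ.* n) ω)))
      (CommutativeRing.0# R)
-- Matching k>1 exposes k as a successor, which supplies the NonZero k instance.
theorem5p2 R k k>1@(s≤s _) c e δ τ α span r _ _ ω ωʳ≈1 s _ r∣kˢ∸1 sq l C hyp n _ =
  [ (λ (induced , Z) → forward-theorem R k c e δ α τ span induced k>1 s ω ωᵏˢ≈ω l C Z n)
  , (λ (induced , Z) → backward-theorem R k c e δ α τ span induced k>1 s ω ωᵏˢ≈ω l C Z n)
  ]′ hyp
  where
  ωᵏˢ≈ω : CommutativeRing._≈_ R (pow R ω (k ^ s)) ω
  ωᵏˢ≈ω = pow-periodic R ωʳ≈1 r∣kˢ∸1 (ℕₚ.m^n>0 k s)
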